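{- Let $\ell$ be a prime, $n\ge1$, $g\ge1$, and let $V$ be a free $\mathbb{Z}/\ell^n\mathbb{Z}$-module of rank $2g$ with a nondegenerate symplectic pairing $\langle\,,\,\rangle_V:V\times V\to\mathbb{Q}/\mathbb{Z}$. Equip the $\ell$-torsion $V[\ell]\subseteq V$ with the induced nondegenerate symplectic pairing $\langle x,y\rangle_{V[\ell]}=\langle x',y\rangle_V$, where $x'\in V$ is any element with $\ell^{n-1}x'=x$. Let $M\subseteq V$ be a maximal isotropic submodule. Then there exists a subgroup $G\subseteq M[\ell]$ which is maximal isotropic in $V[\ell]$ with respect to $\langle\,,\,\rangle_{V[\ell]}$. -}

module Defs where

open import Level using (0ℓ)
open import Data.Nat using (ℕ; _+_; _*_; _^_; _∸_; NonZero)
open import Data.Nat.DivMod using (_mod_)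
open import Data.Fin using (Fin; toℕ)
open import Data.Vec using (Vec; map; zipWith; replicate)
open import Data.Product using (_×_)
open import Relation.Binary.PropositionalEquality using (_≡_)

-- ℤ/mℤ is modelled as Fin m with arithmetic mod m.
-- V = (ℤ/mℤ)^k is modelled as Vec (Fin m) k, with m = ℓ^n, k = 2g.
module _ (m : ℕ) .{{_ : NonZero m}} where

  ZMod : Set
  ZMod = Fin m

  0Z : ZMod
  0Z = 0 mod m

  _+Z_ : ZMod → ZMod → ZMod
  a +Z b = (toℕ a + toℕ b) mod m

  module _ (k : ℕ) where

    V : Set
    V = Vec ZMod k

    0V : V
    0V = replicate k 0Z

    _+V_ : V → V → V
    _+V_ = zipWith _+Z_

    scaleV : ℕ → V → V
    scaleV c = map (λ a → (c * toℕ a) mod m)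

    -- A pairing V × V → ℚ/ℤ necessarily lands in (1/m)ℤ/ℤ ≅ ℤ/mℤ
    -- (via c/m ↦ c); we record it through this identification.
    Pairing : Set
    Pairing = V → V → ZMod

    IsNondegenerateSymplectic : Pairing → Set
    IsNondegenerateSymplectic ω =
      (∀ x y z → ω (x +V y) z ≡ (ω x z +Z ω y z)) ×
      (∀ x y z → ω x (y +V z) ≡ (ω x y +Z ω x z)) ×
      (∀ x → ω x x ≡ 0Z) ×
      (∀ x → (∀ y → ω x y ≡ 0Z) → x ≡ 0V)

    Subset : Set₁
    Subset = V → Set

    _⊆_ : Subset → Subset → Set
    A ⊆ B = ∀ x → A x → B x

    IsSubmodule : Subset → Set
    IsSubmodule S =
      S 0V × (∀ x y → S x → S y → S (x +V y)) × (∀ c x → S x → S (scaleV c x))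

    IsIsotropic : Pairing → Subset → Set
    IsIsotropic ω S = ∀ x y → S x → S y → ω x y ≡ 0Z

    IsMaximalIsotropic : Pairing → Subset → Set₁
    IsMaximalIsotropic ω M =
      IsSubmodule M × IsIsotropic ω M ×
      (∀ N → IsSubmodule N → IsIsotropic ω N → M ⊆ N → N ⊆ M)

    module _ (ℓ n : ℕ) where

      Tors : Subset
      Tors x = scaleV ℓ x ≡ 0V

      -- ⟨x , y⟩_{V[ℓ]} = 0, where ⟨x , y⟩_{V[ℓ]} = ⟨x' , y⟩_V for ℓ^(n-1) x' = x
      IndPairingZero : Pairing → V → V → Set
      IndPairingZero ω x y = ∀ x' → scaleV (ℓ ^ (n ∸ 1)) x' ≡ x → ω x' y ≡ 0Z

      IsSubgroupTors : Subset → Set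
      IsSubgroupTors G = IsSubmodule G × G ⊆ Tors

      IsIsotropicTors : Pairing → Subset → Set
      IsIsotropicTors ω G = ∀ x y → G x → G y → IndPairingZero ω x y

      IsMaximalIsotropicTors : Pairing → Subset → Set₁
      IsMaximalIsotropicTors ω G =
        IsSubgroupTors G × IsIsotropicTors ω G ×
        (∀ H → IsSubgroupTors H → IsIsotropicTors ω H → G ⊆ H → H ⊆ G)

module Submission where

-- Put m = ℓⁿ and p = ℓⁿ⁻¹, so ℓ * p = m.  Two facts are combined.
--  * An isotropic subgroup H of V[ℓ] containing p·M lies in M: for x ∈ H, u ∈ M,
--    ⟨u , x⟩_V = ⟨p u , x⟩_{V[ℓ]} = 0, and a maximal isotropic M contains every
--    vector orthogonal to it (orthogonal⇒∈, isotropic-⊇p·M⇒⊆M).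
--  * A finite set has a maximal clique for any compatibility relation.  As M is an
--    arbitrary predicate the greedy algorithm is described by a relation whose
--    runs exist up to double negation and are unique (module MaximalClique).
-- G is the maximal clique of M ∩ V[ℓ] for "the induced pairing vanishes".  This
-- relation is ¬¬-stable and bilinear on V[ℓ], so G is an isotropic subgroup; it
-- contains p·M, so by the first fact it is maximal.

open import Data.Fin using (toℕ; _≟_)
open import Data.Fin.Properties using (toℕ-injective; toℕ<n; toℕ-fromℕ<)
open import Data.List using (List; []; _∷_; allFin; cartesianProductWith)
open import Data.List.Membership.Propositional using (_∈_)
open import Data.List.Membership.Propositional.Properties
  using (∈-allFin; ∈-cartesianProductWith⁺)
open import Data.List.Relation.Unary.Any using (here; there)
open import Data.Nat
  using (ℕ; zero; suc; _+_; _*_; _^_; _∸_; _≤_; s≤s; _%_; NonZero; ≢-nonZero; ≢-nonZero⁻¹)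
open import Data.Nat.DivMod
  using (_mod_; m%n<n; m%n%n≡m%n; m<n⇒m%n≡m; %-distribˡ-+; %-distribˡ-*; n%n≡0; m*n%n≡0)
open import Data.Nat.Divisibility using (_∣_; divides; *-cancelˡ-∣; m%n≡0⇒n∣m)
open import Data.Nat.Primality using (Prime)
open import Data.Nat.Properties
  using (+-assoc; +-comm; *-assoc; *-comm; *-distribˡ-+; *-distribʳ-+; *-identityˡ; *-zeroʳ; m+[n∸m]≡n; <⇒≤)
open import Data.Product using (Σ; ∃; _×_; _,_; proj₁; proj₂)
open import Data.Vec using ([]; _∷_; head; tail; replicate)
open import Data.Vec.Properties
  using (zipWith-assoc; zipWith-comm; zipWith-identityˡ; map-∘; map-cong; map-id; map-const; map-replicate)
open import Relation.Binary.PropositionalEquality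
  using (_≡_; refl; sym; trans; cong; cong₂; subst; module ≡-Reasoning)
open import Data.Empty using (⊥-elim)
open import Relation.Nullary using (¬_)
open import Relation.Nullary.Decidable using (decidable-stable)

open import Defs

module ZModArith (m : ℕ) .{{_ : NonZero m}} where

  Z : Set
  Z = ZMod m

  0z : Z
  0z = 0Z m

  infixl 6 _⊕_
  _⊕_ : Z → Z → Z
  _⊕_ = _+Z_ m

  infixr 7 _·_
  _·_ : ℕ → Z → Z
  c · a = (c * toℕ a) mod m

  infix 4 _≈_
  _≈_ : ℕ → ℕ → Set
  a ≈ b = a % m ≡ b % m

  toℕ-mod : ∀ a → toℕ (a mod m) ≈ a
  toℕ-mod a = trans (cong (_% m) (toℕ-fromℕ< (m%n<n a m))) (m%n%n≡m%n a m)

  ≈⇒≡ : {a b : Z} → toℕ a ≈ toℕ b → a ≡ b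
  ≈⇒≡ {a} {b} a≈b =
    toℕ-injective (trans (sym (m<n⇒m%n≡m (toℕ<n a))) (trans a≈b (m<n⇒m%n≡m (toℕ<n b))))

  +-cong-≈ : ∀ {a a′ b b′} → a ≈ a′ → b ≈ b′ → a + b ≈ a′ + b′
  +-cong-≈ {a} {a′} {b} {b′} a≈a′ b≈b′ = begin
    (a + b) % m                 ≡⟨ %-distribˡ-+ a b m ⟩
    (a % m + b % m) % m         ≡⟨ cong₂ (λ x y → (x + y) % m) a≈a′ b≈b′ ⟩
    (a′ % m + b′ % m) % m       ≡⟨ %-distribˡ-+ a′ b′ m ⟨
    (a′ + b′) % m               ∎
    where open ≡-Reasoning

  *-congˡ-≈ : ∀ c {b b′} → b ≈ b′ → c * b ≈ c * b′
  *-congˡ-≈ c {b} {b′} b≈b′ = begin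
    (c * b) % m                 ≡⟨ %-distribˡ-* c b m ⟩
    (c % m * (b % m)) % m       ≡⟨ cong (λ y → (c % m * y) % m) b≈b′ ⟩
    (c % m * (b′ % m)) % m      ≡⟨ %-distribˡ-* c b′ m ⟨
    (c * b′) % m                ∎
    where open ≡-Reasoning

  toℕ-⊕ : ∀ a b → toℕ (a ⊕ b) ≈ toℕ a + toℕ b
  toℕ-⊕ a b = toℕ-mod (toℕ a + toℕ b)

  toℕ-· : ∀ c a → toℕ (c · a) ≈ c * toℕ a
  toℕ-· c a = toℕ-mod (c * toℕ a)

  ≡⇒≈ : ∀ {a b} → a ≡ b → a ≈ b
  ≡⇒≈ = cong (_% m)

  ⊕-assoc : ∀ a b c → (a ⊕ b) ⊕ c ≡ a ⊕ (b ⊕ c)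
  ⊕-assoc a b c = ≈⇒≡ (begin
    toℕ ((a ⊕ b) ⊕ c) % m                ≡⟨ toℕ-⊕ (a ⊕ b) c ⟩
    (toℕ (a ⊕ b) + toℕ c) % m            ≡⟨ +-cong-≈ (toℕ-⊕ a b) refl ⟩
    (toℕ a + toℕ b + toℕ c) % m          ≡⟨ ≡⇒≈ (+-assoc (toℕ a) (toℕ b) (toℕ c)) ⟩
    (toℕ a + (toℕ b + toℕ c)) % m        ≡⟨ +-cong-≈ refl (toℕ-⊕ b c) ⟨
    (toℕ a + toℕ (b ⊕ c)) % m            ≡⟨ toℕ-⊕ a (b ⊕ c) ⟨
    toℕ (a ⊕ (b ⊕ c)) % m                ∎)
    where open ≡-Reasoning

  ⊕-comm : ∀ a b → a ⊕ b ≡ b ⊕ a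
  ⊕-comm a b = ≈⇒≡ (trans (toℕ-⊕ a b)
                    (trans (≡⇒≈ (+-comm (toℕ a) (toℕ b))) (sym (toℕ-⊕ b a))))

  ⊕-identityˡ : ∀ a → 0z ⊕ a ≡ a
  ⊕-identityˡ a = ≈⇒≡ (trans (toℕ-⊕ 0z a) (+-cong-≈ (toℕ-mod 0) refl))

  ⊕-identityʳ : ∀ a → a ⊕ 0z ≡ a
  ⊕-identityʳ a = trans (⊕-comm a 0z) (⊕-identityˡ a)

  -- an element equal to its double is zero (cancel it by its negative m - a)
  ⊕-idem⇒0 : ∀ a → a ⊕ a ≡ a → a ≡ 0z
  ⊕-idem⇒0 a a⊕a≡a = begin
    a                   ≡⟨ ⊕-identityʳ a ⟨
    a ⊕ 0z              ≡⟨ cong (a ⊕_) a⊕-a≡0 ⟨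
    a ⊕ (a ⊕ -a)        ≡⟨ ⊕-assoc a a -a ⟨
    (a ⊕ a) ⊕ -a        ≡⟨ cong (_⊕ -a) a⊕a≡a ⟩
    a ⊕ -a              ≡⟨ a⊕-a≡0 ⟩
    0z                  ∎
    where
    open ≡-Reasoning
    -a : Z
    -a = (m ∸ toℕ a) mod m
    a⊕-a≡0 : a ⊕ -a ≡ 0z
    a⊕-a≡0 = ≈⇒≡ (begin
      toℕ (a ⊕ -a) % m                  ≡⟨ toℕ-⊕ a -a ⟩
      (toℕ a + toℕ -a) % m              ≡⟨ +-cong-≈ refl (toℕ-mod (m ∸ toℕ a)) ⟩
      (toℕ a + (m ∸ toℕ a)) % m         ≡⟨ ≡⇒≈ (m+[n∸m]≡n (<⇒≤ (toℕ<n a))) ⟩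
      m % m                             ≡⟨ n%n≡0 m ⟩
      0                                 ≡⟨ m*n%n≡0 0 m ⟨
      0 % m                             ≡⟨ toℕ-mod 0 ⟨
      toℕ 0z % m                        ∎)

  ·-distribˡ-⊕ : ∀ c a b → c · (a ⊕ b) ≡ c · a ⊕ c · b
  ·-distribˡ-⊕ c a b = ≈⇒≡ (begin
    toℕ (c · (a ⊕ b)) % m                ≡⟨ toℕ-· c (a ⊕ b) ⟩
    (c * toℕ (a ⊕ b)) % m                ≡⟨ *-congˡ-≈ c (toℕ-⊕ a b) ⟩
    (c * (toℕ a + toℕ b)) % m            ≡⟨ ≡⇒≈ (*-distribˡ-+ c (toℕ a) (toℕ b)) ⟩
    (c * toℕ a + c * toℕ b) % m          ≡⟨ +-cong-≈ (toℕ-· c a) (toℕ-· c b) ⟨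
    (toℕ (c · a) + toℕ (c · b)) % m      ≡⟨ toℕ-⊕ (c · a) (c · b) ⟨
    toℕ (c · a ⊕ c · b) % m              ∎)
    where open ≡-Reasoning

  ·-distribʳ-+ : ∀ c d a → (c + d) · a ≡ c · a ⊕ d · a
  ·-distribʳ-+ c d a = ≈⇒≡ (begin
    toℕ ((c + d) · a) % m                ≡⟨ toℕ-· (c + d) a ⟩
    ((c + d) * toℕ a) % m                ≡⟨ ≡⇒≈ (*-distribʳ-+ (toℕ a) c d) ⟩
    (c * toℕ a + d * toℕ a) % m          ≡⟨ +-cong-≈ (toℕ-· c a) (toℕ-· d a) ⟨
    (toℕ (c · a) + toℕ (d · a)) % m      ≡⟨ toℕ-⊕ (c · a) (d · a) ⟨
    toℕ (c · a ⊕ d · a) % m              ∎)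
    where open ≡-Reasoning

  ·-assoc : ∀ c d a → c · (d · a) ≡ (c * d) · a
  ·-assoc c d a = ≈⇒≡ (begin
    toℕ (c · (d · a)) % m                ≡⟨ toℕ-· c (d · a) ⟩
    (c * toℕ (d · a)) % m                ≡⟨ *-congˡ-≈ c (toℕ-· d a) ⟩
    (c * (d * toℕ a)) % m                ≡⟨ ≡⇒≈ (*-assoc c d (toℕ a)) ⟨
    (c * d * toℕ a) % m                  ≡⟨ toℕ-· (c * d) a ⟨
    toℕ ((c * d) · a) % m                ∎)
    where open ≡-Reasoning

  ·-identityˡ : ∀ a → 1 · a ≡ a
  ·-identityˡ a = ≈⇒≡ (trans (toℕ-· 1 a) (≡⇒≈ (*-identityˡ (toℕ a))))

  ·-suc : ∀ c a → suc c · a ≡ a ⊕ c · a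
  ·-suc c a = trans (·-distribʳ-+ 1 c a) (cong (_⊕ c · a) (·-identityˡ a))

  ·-zeroʳ : ∀ c → c · 0z ≡ 0z
  ·-zeroʳ c = ≈⇒≡ (begin
    toℕ (c · 0z) % m                     ≡⟨ toℕ-· c 0z ⟩
    (c * toℕ 0z) % m                     ≡⟨ *-congˡ-≈ c (toℕ-mod 0) ⟩
    (c * 0) % m                          ≡⟨ ≡⇒≈ (*-zeroʳ c) ⟩
    0 % m                                ≡⟨ toℕ-mod 0 ⟨
    toℕ 0z % m                           ∎)
    where open ≡-Reasoning

  m·-annihilates : ∀ a → m · a ≡ 0z
  m·-annihilates a = ≈⇒≡ (begin
    toℕ (m · a) % m                      ≡⟨ toℕ-· m a ⟩
    (m * toℕ a) % m                      ≡⟨ ≡⇒≈ (*-comm m (toℕ a)) ⟩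
    (toℕ a * m) % m                      ≡⟨ m*n%n≡0 (toℕ a) m ⟩
    0                                    ≡⟨ m*n%n≡0 0 m ⟨
    0 % m                                ≡⟨ toℕ-mod 0 ⟨
    toℕ 0z % m                           ∎)
    where open ≡-Reasoning

module VecArith (m : ℕ) .{{_ : NonZero m}} where
  open ZModArith m

  infixl 6 _+v_
  _+v_ : ∀ {k} → V m k → V m k → V m k
  _+v_ {k} = _+V_ m k

  0v : ∀ {k} → V m k
  0v {k} = 0V m k

  infixr 7 _·v_
  _·v_ : ∀ {k} → ℕ → V m k → V m k
  _·v_ {k} = scaleV m k

  +v-assoc : ∀ {k} (x y z : V m k) → (x +v y) +v z ≡ x +v (y +v z)
  +v-assoc = zipWith-assoc ⊕-assoc

  +v-comm : ∀ {k} (x y : V m k) → x +v y ≡ y +v x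
  +v-comm = zipWith-comm ⊕-comm

  +v-identityˡ : ∀ {k} (x : V m k) → 0v +v x ≡ x
  +v-identityˡ = zipWith-identityˡ ⊕-identityˡ

  +v-identityʳ : ∀ {k} (x : V m k) → x +v 0v ≡ x
  +v-identityʳ x = trans (+v-comm x 0v) (+v-identityˡ x)

  +v-interchange : ∀ {k} (a b c d : V m k) → (a +v b) +v (c +v d) ≡ (a +v c) +v (b +v d)
  +v-interchange a b c d = begin
    (a +v b) +v (c +v d)   ≡⟨ +v-assoc a b (c +v d) ⟩
    a +v (b +v (c +v d))   ≡⟨ cong (a +v_) (+v-assoc b c d) ⟨
    a +v ((b +v c) +v d)   ≡⟨ cong (λ z → a +v (z +v d)) (+v-comm b c) ⟩
    a +v ((c +v b) +v d)   ≡⟨ cong (a +v_) (+v-assoc c b d) ⟩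
    a +v (c +v (b +v d))   ≡⟨ +v-assoc a c (b +v d) ⟨
    (a +v c) +v (b +v d)   ∎
    where open ≡-Reasoning

  ·v-distribˡ-+v : ∀ {k} c (x y : V m k) → c ·v (x +v y) ≡ c ·v x +v c ·v y
  ·v-distribˡ-+v c []       []       = refl
  ·v-distribˡ-+v c (a ∷ x) (b ∷ y) = cong₂ _∷_ (·-distribˡ-⊕ c a b) (·v-distribˡ-+v c x y)

  ·v-distribʳ-+ : ∀ {k} c d (x : V m k) → (c + d) ·v x ≡ c ·v x +v d ·v x
  ·v-distribʳ-+ c d []      = refl
  ·v-distribʳ-+ c d (a ∷ x) = cong₂ _∷_ (·-distribʳ-+ c d a) (·v-distribʳ-+ c d x)

  ·v-assoc : ∀ {k} c d (x : V m k) → c ·v (d ·v x) ≡ (c * d) ·v x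
  ·v-assoc c d x = trans (sym (map-∘ _ _ x)) (map-cong (·-assoc c d) x)

  ·v-comm : ∀ {k} c d (x : V m k) → c ·v (d ·v x) ≡ d ·v (c ·v x)
  ·v-comm c d x = trans (·v-assoc c d x)
                        (trans (cong (_·v x) (*-comm c d)) (sym (·v-assoc d c x)))

  ·v-identityˡ : ∀ {k} (x : V m k) → 1 ·v x ≡ x
  ·v-identityˡ x = trans (map-cong ·-identityˡ x) (map-id x)

  ·v-suc : ∀ {k} c (x : V m k) → suc c ·v x ≡ x +v c ·v x
  ·v-suc c x = trans (·v-distribʳ-+ 1 c x) (cong (_+v c ·v x) (·v-identityˡ x))

  ·v-zeroˡ : ∀ {k} (x : V m k) → 0 ·v x ≡ 0v
  ·v-zeroˡ x = map-const x 0z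

  ·v-zeroʳ : ∀ {k} c → c ·v 0v {k} ≡ 0v
  ·v-zeroʳ {k} c = trans (map-replicate _ 0z k) (cong (replicate k) (·-zeroʳ c))

  m·v-annihilates : ∀ {k} (x : V m k) → m ·v x ≡ 0v
  m·v-annihilates x = trans (map-cong m·-annihilates x) (map-const x 0z)

  -- every vector is a list of its coordinates, so V is finite
  allVectors : ∀ k → List (V m k)
  allVectors zero    = [] ∷ []
  allVectors (suc k) = cartesianProductWith _∷_ (allFin m) (allVectors k)

  ∈-allVectors : ∀ {k} (x : V m k) → x ∈ allVectors k
  ∈-allVectors []      = here refl
  ∈-allVectors (a ∷ x) = ∈-cartesianProductWith⁺ _∷_ (∈-allFin a) (∈-allVectors x)

-- ℓ-torsion in V, where m = ℓ * p.  Every ℓ-torsion vector is a p-multiple;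
-- this is what lets the pairing on V[ℓ] be defined through p-th "roots".
module ℓTorsion (m : ℕ) .{{_ : NonZero m}} (ℓ p : ℕ) (ℓp≡m : ℓ * p ≡ m) where
  open ZModArith m
  open VecArith m

  Torsion : ∀ {k} → V m k → Set
  Torsion x = ℓ ·v x ≡ 0v

  lift-torsionZ : ∀ a → ℓ · a ≡ 0z → ∃ λ b → p · b ≡ a
  lift-torsionZ a ℓa≡0 = fromDivides (*-cancelˡ-∣ ℓ (subst (_∣ ℓ * toℕ a) (sym ℓp≡m) m∣ℓa))
    where
    instance
      ℓ≢0 : NonZero ℓ
      ℓ≢0 = ≢-nonZero (λ ℓ≡0 → ≢-nonZero⁻¹ m (trans (sym ℓp≡m) (cong (_* p) ℓ≡0)))

    m∣ℓa : m ∣ ℓ * toℕ a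
    m∣ℓa = m%n≡0⇒n∣m _ m (begin
      (ℓ * toℕ a) % m          ≡⟨ toℕ-· ℓ a ⟨
      toℕ (ℓ · a) % m          ≡⟨ cong (λ z → toℕ z % m) ℓa≡0 ⟩
      toℕ 0z % m               ≡⟨ toℕ-mod 0 ⟩
      0 % m                    ≡⟨ m*n%n≡0 0 m ⟩
      0                        ∎)
      where open ≡-Reasoning

    fromDivides : p ∣ toℕ a → ∃ λ b → p · b ≡ a
    fromDivides (divides q a≡q*p) = q mod m , ≈⇒≡ (begin
      toℕ (p · (q mod m)) % m  ≡⟨ toℕ-· p (q mod m) ⟩
      (p * toℕ (q mod m)) % m  ≡⟨ *-congˡ-≈ p (toℕ-mod q) ⟩
      (p * q) % m              ≡⟨ ≡⇒≈ (trans (*-comm p q) (sym a≡q*p)) ⟩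
      toℕ a % m                ∎)
      where open ≡-Reasoning

  lift-torsion : ∀ {k} (x : V m k) → Torsion x → ∃ λ x′ → p ·v x′ ≡ x
  lift-torsion []      _    = [] , refl
  lift-torsion (a ∷ x) ℓx≡0
    with lift-torsionZ a (cong head ℓx≡0) | lift-torsion x (cong tail ℓx≡0)
  ... | b , pb≡a | x′ , px′≡x = b ∷ x′ , cong₂ _∷_ pb≡a px′≡x

  Torsion-zero : ∀ {k} → Torsion (0v {k})
  Torsion-zero = ·v-zeroʳ ℓ

  Torsion-+ : ∀ {k} {x y : V m k} → Torsion x → Torsion y → Torsion (x +v y)
  Torsion-+ {x = x} {y} ℓx≡0 ℓy≡0 =
    trans (·v-distribˡ-+v ℓ x y) (trans (cong₂ _+v_ ℓx≡0 ℓy≡0) (+v-identityˡ 0v))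

  Torsion-· : ∀ {k} {x : V m k} c → Torsion x → Torsion (c ·v x)
  Torsion-· {x = x} c ℓx≡0 = trans (·v-comm ℓ c x) (trans (cong (c ·v_) ℓx≡0) (·v-zeroʳ c))

  Torsion-p· : ∀ {k} (x : V m k) → Torsion (p ·v x)
  Torsion-p· x = trans (·v-assoc ℓ p x) (trans (cong (_·v x) ℓp≡m) (m·v-annihilates x))

-- Biadditive alternating pairings ω on V = (ℤ/mℤ)ᵏ.
module AlternatingPairing
  (m : ℕ) .{{_ : NonZero m}} (k : ℕ) (ω : Pairing m k)
  (additiveˡ : ∀ x y z → ω (_+V_ m k x y) z ≡ _+Z_ m (ω x z) (ω y z))
  (additiveʳ : ∀ x y z → ω x (_+V_ m k y z) ≡ _+Z_ m (ω x y) (ω x z))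
  (alternating : ∀ x → ω x x ≡ 0Z m)
  where
  open ZModArith m
  open VecArith m

  ω-zeroˡ : ∀ y → ω 0v y ≡ 0z
  ω-zeroˡ y = ⊕-idem⇒0 _ (sym (trans (cong (λ v → ω v y) (sym (+v-identityˡ 0v))) (additiveˡ 0v 0v y)))

  ω-zeroʳ : ∀ x → ω x 0v ≡ 0z
  ω-zeroʳ x = ⊕-idem⇒0 _ (sym (trans (cong (ω x) (sym (+v-identityˡ 0v))) (additiveʳ x 0v 0v)))

  ω-scaleˡ : ∀ c x y → ω (c ·v x) y ≡ c · ω x y
  ω-scaleˡ zero    x y = trans (cong (λ v → ω v y) (·v-zeroˡ x)) (ω-zeroˡ y)
  ω-scaleˡ (suc c) x y = begin
    ω (suc c ·v x) y          ≡⟨ cong (λ v → ω v y) (·v-suc c x) ⟩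
    ω (x +v c ·v x) y         ≡⟨ additiveˡ x (c ·v x) y ⟩
    ω x y ⊕ ω (c ·v x) y      ≡⟨ cong (ω x y ⊕_) (ω-scaleˡ c x y) ⟩
    ω x y ⊕ c · ω x y         ≡⟨ ·-suc c (ω x y) ⟨
    suc c · ω x y             ∎
    where open ≡-Reasoning

  ω-scaleʳ : ∀ c x y → ω x (c ·v y) ≡ c · ω x y
  ω-scaleʳ zero    x y = trans (cong (ω x) (·v-zeroˡ y)) (ω-zeroʳ x)
  ω-scaleʳ (suc c) x y = begin
    ω x (suc c ·v y)          ≡⟨ cong (ω x) (·v-suc c y) ⟩
    ω x (y +v c ·v y)         ≡⟨ additiveʳ x y (c ·v y) ⟩
    ω x y ⊕ ω x (c ·v y)      ≡⟨ cong (ω x y ⊕_) (ω-scaleʳ c x y) ⟩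
    ω x y ⊕ c · ω x y         ≡⟨ ·-suc c (ω x y) ⟨
    suc c · ω x y             ∎
    where open ≡-Reasoning

  infix 4 _⊥_
  _⊥_ : V m k → V m k → Set
  x ⊥ y = ω x y ≡ 0z

  private
    ⊕-zero : ∀ {a b} → a ≡ 0z → b ≡ 0z → a ⊕ b ≡ 0z
    ⊕-zero refl refl = ⊕-identityˡ 0z

  ⊥-+ˡ : ∀ {x y z} → x ⊥ z → y ⊥ z → x +v y ⊥ z
  ⊥-+ˡ {x} {y} {z} x⊥z y⊥z = trans (additiveˡ x y z) (⊕-zero x⊥z y⊥z)

  ⊥-+ʳ : ∀ {x y z} → x ⊥ y → x ⊥ z → x ⊥ y +v z
  ⊥-+ʳ {x} {y} {z} x⊥y x⊥z = trans (additiveʳ x y z) (⊕-zero x⊥y x⊥z)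

  ⊥-·ˡ : ∀ {x y} c → x ⊥ y → c ·v x ⊥ y
  ⊥-·ˡ {x} {y} c x⊥y = trans (ω-scaleˡ c x y) (trans (cong (c ·_) x⊥y) (·-zeroʳ c))

  ⊥-·ʳ : ∀ {x y} c → x ⊥ y → x ⊥ c ·v y
  ⊥-·ʳ {x} {y} c x⊥y = trans (ω-scaleʳ c x y) (trans (cong (c ·_) x⊥y) (·-zeroʳ c))

  -- an alternating pairing is antisymmetric, so orthogonality is symmetric
  ⊥-sym : ∀ {x y} → x ⊥ y → y ⊥ x
  ⊥-sym {x} {y} x⊥y = begin
    ω y x                                  ≡⟨ ⊕-identityˡ (ω y x) ⟨
    0z ⊕ ω y x                             ≡⟨ cong (_⊕ ω y x) (⊕-identityˡ 0z) ⟨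
    0z ⊕ 0z ⊕ ω y x                        ≡⟨ cong₂ (λ a b → a ⊕ b ⊕ ω y x) (alternating x) x⊥y ⟨
    ω x x ⊕ ω x y ⊕ ω y x                  ≡⟨ cong (ω x x ⊕ ω x y ⊕_) (⊕-identityʳ (ω y x)) ⟨
    ω x x ⊕ ω x y ⊕ (ω y x ⊕ 0z)           ≡⟨ cong (λ b → ω x x ⊕ ω x y ⊕ (ω y x ⊕ b)) (alternating y) ⟨
    ω x x ⊕ ω x y ⊕ (ω y x ⊕ ω y y)        ≡⟨ cong₂ _⊕_ (additiveʳ x x y) (additiveʳ y x y) ⟨
    ω x (x +v y) ⊕ ω y (x +v y)            ≡⟨ additiveˡ x y (x +v y) ⟨
    ω (x +v y) (x +v y)                    ≡⟨ alternating (x +v y) ⟩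
    0z                                     ∎
    where open ≡-Reasoning

  -- A maximal isotropic submodule contains every vector orthogonal to it:
  -- adding such an x keeps M + ℕ·x isotropic.
  module _ (M : Subset m k) (maximal : IsMaximalIsotropic m k ω M) where
    private
      M-zero = proj₁ (proj₁ maximal)
      M-+ = proj₁ (proj₂ (proj₁ maximal))
      M-· = proj₂ (proj₂ (proj₁ maximal))
      M-isotropic = proj₁ (proj₂ maximal)
      M-maximal = proj₂ (proj₂ maximal)

    orthogonal⇒∈ : ∀ x → (∀ u → M u → x ⊥ u) → M x
    orthogonal⇒∈ x x⊥M = M-maximal M+x M+x-submodule M+x-isotropic M⊆M+x x x∈M+x
      where
      M+x : Subset m k
      M+x z = Σ (V m k) λ u → Σ ℕ λ c → M u × z ≡ u +v c ·v x

      M+x-isotropic : IsIsotropic m k ω M+x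
      M+x-isotropic _ _ (u , c , u∈M , refl) (u′ , c′ , u′∈M , refl) =
        ⊥-+ˡ (⊥-+ʳ (M-isotropic u u′ u∈M u′∈M) (⊥-·ʳ c′ (⊥-sym (x⊥M u u∈M))))
             (⊥-·ˡ c (⊥-+ʳ (x⊥M u′ u′∈M) (⊥-·ʳ c′ (alternating x))))

      M+x-submodule : IsSubmodule m k M+x
      M+x-submodule =
          (0v , 0 , M-zero , sym (trans (cong (0v +v_) (·v-zeroˡ x)) (+v-identityˡ 0v)))
        , (λ { _ _ (u , c , u∈M , refl) (u′ , c′ , u′∈M , refl) →
                 u +v u′ , c + c′ , M-+ u u′ u∈M u′∈M ,
                 trans (+v-interchange u (c ·v x) u′ (c′ ·v x))
                       (cong (u +v u′ +v_) (sym (·v-distribʳ-+ c c′ x))) })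
        , (λ { d _ (u , c , u∈M , refl) →
                 d ·v u , d * c , M-· d u u∈M ,
                 trans (·v-distribˡ-+v d u (c ·v x)) (cong (d ·v u +v_) (·v-assoc d c x)) })

      M⊆M+x : _⊆_ m k M M+x
      M⊆M+x z z∈M = z , 0 , z∈M , sym (trans (cong (z +v_) (·v-zeroˡ x)) (+v-identityʳ z))

      x∈M+x : M+x x
      x∈M+x = 0v , 1 , M-zero , sym (trans (+v-identityˡ (1 ·v x)) (·v-identityˡ x))

  -- The induced pairing on V[ℓ] for m = ℓ * p: ⟨x , y⟩_{V[ℓ]} = ω x′ y with p·x′ = x.
  module InducedPairing (ℓ p : ℕ) (ℓp≡m : ℓ * p ≡ m) where
    open ℓTorsion m ℓ p ℓp≡m

    IndZero : V m k → V m k → Set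
    IndZero x y = ∀ x′ → p ·v x′ ≡ x → x′ ⊥ y

    -- ω x′ y for y ∈ V[ℓ] depends only on p·x′: the induced pairing is well defined
    ω-p-invariant : ∀ {y u v} → Torsion y → p ·v u ≡ p ·v v → ω u y ≡ ω v y
    ω-p-invariant {y} {u} {v} ℓy≡0 pu≡pv with lift-torsion y ℓy≡0
    ... | y′ , refl = begin
      ω u (p ·v y′)     ≡⟨ ω-scaleʳ p u y′ ⟩
      p · ω u y′        ≡⟨ ω-scaleˡ p u y′ ⟨
      ω (p ·v u) y′     ≡⟨ cong (λ w → ω w y′) pu≡pv ⟩
      ω (p ·v v) y′     ≡⟨ ω-scaleˡ p v y′ ⟩
      p · ω v y′        ≡⟨ ω-scaleʳ p v y′ ⟨
      ω v (p ·v y′)     ∎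
      where open ≡-Reasoning

    IndZero-via-lift : ∀ {x y} x₀ → Torsion y → p ·v x₀ ≡ x → x₀ ⊥ y → IndZero x y
    IndZero-via-lift x₀ ℓy≡0 px₀≡x x₀⊥y x′ px′≡x =
      trans (ω-p-invariant ℓy≡0 (trans px′≡x (sym px₀≡x))) x₀⊥y

    -- vanishing is ¬¬-stable, since ℤ/mℤ has decidable equality
    IndZero-stable : ∀ {x y} → ¬ ¬ IndZero x y → IndZero x y
    IndZero-stable {y = y} ¬¬h x′ px′≡x =
      decidable-stable (ω x′ y ≟ 0z) (λ x′⊥̸y → ¬¬h (λ h → x′⊥̸y (h x′ px′≡x)))

    IndZero-zeroʳ : ∀ x → IndZero x 0v
    IndZero-zeroʳ _ x′ _ = ω-zeroʳ x′

    IndZero-zeroˡ : ∀ {y} → Torsion y → IndZero 0v y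
    IndZero-zeroˡ {y} ℓy≡0 = IndZero-via-lift 0v ℓy≡0 (·v-zeroʳ p) (ω-zeroˡ y)

    IndZero-+ʳ : ∀ {x y z} → IndZero x y → IndZero x z → IndZero x (y +v z)
    IndZero-+ʳ x⊥y x⊥z x′ px′≡x = ⊥-+ʳ (x⊥y x′ px′≡x) (x⊥z x′ px′≡x)

    IndZero-+ˡ : ∀ {x y z} → Torsion x → Torsion y → Torsion z →
                 IndZero x z → IndZero y z → IndZero (x +v y) z
    IndZero-+ˡ {x} {y} ℓx≡0 ℓy≡0 ℓz≡0 x⊥z y⊥z
      with lift-torsion x ℓx≡0 | lift-torsion y ℓy≡0
    ... | x₀ , px₀≡x | y₀ , py₀≡y =
      IndZero-via-lift (x₀ +v y₀) ℓz≡0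
        (trans (·v-distribˡ-+v p x₀ y₀) (cong₂ _+v_ px₀≡x py₀≡y))
        (⊥-+ˡ (x⊥z x₀ px₀≡x) (y⊥z y₀ py₀≡y))

    IndZero-·ʳ : ∀ {x y} c → IndZero x y → IndZero x (c ·v y)
    IndZero-·ʳ c x⊥y x′ px′≡x = ⊥-·ʳ c (x⊥y x′ px′≡x)

    IndZero-·ˡ : ∀ {x y} c → Torsion x → Torsion y → IndZero x y → IndZero (c ·v x) y
    IndZero-·ˡ {x} c ℓx≡0 ℓy≡0 x⊥y with lift-torsion x ℓx≡0
    ... | x₀ , px₀≡x =
      IndZero-via-lift (c ·v x₀) ℓy≡0
        (trans (·v-comm p c x₀) (cong (c ·v_) px₀≡x))
        (⊥-·ˡ c (x⊥y x₀ px₀≡x))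

    IndZero-p·ˡ : ∀ {u y} → Torsion y → u ⊥ y → IndZero (p ·v u) y
    IndZero-p·ˡ {u} ℓy≡0 u⊥y = IndZero-via-lift u ℓy≡0 refl u⊥y

    IndZero-p·ʳ : ∀ {x u} → x ⊥ u → IndZero x (p ·v u)
    IndZero-p·ʳ {x} {u} x⊥u x′ px′≡x = begin
      ω x′ (p ·v u)     ≡⟨ ω-scaleʳ p x′ u ⟩
      p · ω x′ u        ≡⟨ ω-scaleˡ p x′ u ⟨
      ω (p ·v x′) u     ≡⟨ cong (λ w → ω w u) px′≡x ⟩
      ω x u             ≡⟨ x⊥u ⟩
      0z                ∎
      where open ≡-Reasoning

-- Vertices are the elements satisfying P, and
-- R a b says a and b are compatible (a vertex must be compatible with itself).
-- The greedy algorithm scans an enumeration, adding each element compatible with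
-- everything chosen so far.  P and R need not be decidable, so a greedy run is
-- a relation: it exists up to double negation and is unique.
module MaximalClique {A : Set} (P : A → Set) (R : A → A → Set) where

  Extends : List A → A → Set
  Extends F y = P y × R y y × (∀ a → a ∈ F → R a y × R y a)

  data Greedy : List A → List A → List A → Set where
    done : ∀ {F} → Greedy F [] F
    add  : ∀ {F y ys F′} → Extends F y → Greedy (y ∷ F) ys F′ → Greedy F (y ∷ ys) F′
    skip : ∀ {F y ys F′} → ¬ Extends F y → Greedy F ys F′ → Greedy F (y ∷ ys) F′

  -- a run exists classically: each step is a case distinction on Extends F y
  greedy-exists : ∀ F ys → ¬ ¬ ∃ (Greedy F ys)
  greedy-exists F []       noRun = noRun (F , done)
  greedy-exists F (y ∷ ys) noRun = ¬¬extends ¬extends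
    where
    ¬¬extends : ¬ ¬ Extends F y
    ¬¬extends ¬e = greedy-exists F ys (λ (F′ , run) → noRun (F′ , skip ¬e run))
    ¬extends : ¬ Extends F y
    ¬extends e = greedy-exists (y ∷ F) ys (λ (F′ , run) → noRun (F′ , add e run))

  greedy-unique : ∀ {F ys F′ F″} → Greedy F ys F′ → Greedy F ys F″ → F′ ≡ F″
  greedy-unique done         done         = refl
  greedy-unique (add _ r)    (add _ r′)   = greedy-unique r r′
  greedy-unique (add e _)    (skip ¬e _)  = ⊥-elim (¬e e)
  greedy-unique (skip ¬e _)  (add e _)    = ⊥-elim (¬e e)
  greedy-unique (skip _ r)   (skip _ r′)  = greedy-unique r r′

  greedy-keeps : ∀ {F ys F′} → Greedy F ys F′ → ∀ {a} → a ∈ F → a ∈ F′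
  greedy-keeps done       a∈F = a∈F
  greedy-keeps (add _ r)  a∈F = greedy-keeps r (there a∈F)
  greedy-keeps (skip _ r) a∈F = greedy-keeps r a∈F

  greedy-maximal : ∀ {F ys F′} → Greedy F ys F′ → ∀ {y} → y ∈ ys → Extends F′ y → y ∈ F′
  greedy-maximal (add _ r)   (here refl) _ = greedy-keeps r (here refl)
  greedy-maximal (skip ¬e r) (here refl) (py , ryy , compat) =
    ⊥-elim (¬e (py , ryy , λ a a∈F → compat a (greedy-keeps r a∈F)))
  greedy-maximal (add _ r)   (there y∈ys) e = greedy-maximal r y∈ys e
  greedy-maximal (skip _ r)  (there y∈ys) e = greedy-maximal r y∈ys e

  IsClique : List A → Set
  IsClique F = ∀ a → a ∈ F → P a × (∀ b → b ∈ F → R a b)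

  greedy-clique : ∀ {F ys F′} → IsClique F → Greedy F ys F′ → IsClique F′
  greedy-clique clique done = clique
  greedy-clique clique (add e r) = greedy-clique (extend clique e) r
    where
    extend : ∀ {F y} → IsClique F → Extends F y → IsClique (y ∷ F)
    extend _      (py , ryy , compat) _ (here refl) =
      py , λ { _ (here refl) → ryy ; b (there b∈F) → proj₂ (compat b b∈F) }
    extend clique (_ , _ , compat)    a (there a∈F) =
      proj₁ (clique a a∈F) ,
      λ { _ (here refl) → proj₁ (compat a a∈F) ; b (there b∈F) → proj₂ (clique a a∈F) b b∈F }
  greedy-clique clique (skip _ r) = greedy-clique clique r

  -- Given an enumeration of A, the maximal clique consists of the vertices
  -- belonging to the result of every greedy run over it.
  module FromEnumeration (xs : List A) (xs-complete : ∀ x → x ∈ xs) where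

    MaxClique : A → Set
    MaxClique x = P x × (∀ F → Greedy [] xs F → x ∈ F)

    private
      ∈run⇒MaxClique : ∀ {F} → Greedy [] xs F → ∀ {a} → a ∈ F → MaxClique a
      ∈run⇒MaxClique r {a} a∈F =
        proj₁ (greedy-clique (λ _ ()) r a a∈F) ,
        λ F′ r′ → subst (a ∈_) (greedy-unique r r′) a∈F

    MaxClique-compatible : ∀ {x y} → MaxClique x → MaxClique y → ¬ ¬ R x y
    MaxClique-compatible (_ , x∈runs) (_ , y∈runs) ¬rxy =
      greedy-exists [] xs λ (F , r) →
        ¬rxy (proj₂ (greedy-clique (λ _ ()) r _ (x∈runs F r)) _ (y∈runs F r))

    MaxClique-maximal : ∀ {y} → P y → R y y → (∀ a → MaxClique a → R a y × R y a) → MaxClique y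
    MaxClique-maximal {y} py ryy compat =
      py , λ F r → greedy-maximal r (xs-complete y)
                     (py , ryy , λ a a∈F → compat a (∈run⇒MaxClique r a∈F))

module TorsionOfMaximalIsotropic
  (m : ℕ) .{{_ : NonZero m}} (k : ℕ) (ω : Pairing m k)
  (additiveˡ : ∀ x y z → ω (_+V_ m k x y) z ≡ _+Z_ m (ω x z) (ω y z))
  (additiveʳ : ∀ x y z → ω x (_+V_ m k y z) ≡ _+Z_ m (ω x y) (ω x z))
  (alternating : ∀ x → ω x x ≡ 0Z m)
  (ℓ n : ℕ) (ℓp≡m : ℓ * ℓ ^ (n ∸ 1) ≡ m)
  (M : Subset m k) (M-maximal : IsMaximalIsotropic m k ω M)
  where
  open VecArith m
  open AlternatingPairing m k ω additiveˡ additiveʳ alternating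
  open ℓTorsion m ℓ (ℓ ^ (n ∸ 1)) ℓp≡m
  open InducedPairing ℓ (ℓ ^ (n ∸ 1)) ℓp≡m

  private
    p : ℕ
    p = ℓ ^ (n ∸ 1)
    M-· = proj₂ (proj₂ (proj₁ M-maximal))
    M-isotropic = proj₁ (proj₂ M-maximal)

  -- an isotropic subgroup of V[ℓ] containing p·M lies in M:
  -- for x ∈ H and u ∈ M, ω u x is the induced pairing of p·u and x
  isotropic-⊇p·M⇒⊆M : ∀ H → IsIsotropicTors m k ℓ n ω H →
                      (∀ u → M u → H (p ·v u)) → _⊆_ m k H M
  isotropic-⊇p·M⇒⊆M H H-isotropic p·M⊆H x x∈H =
    orthogonal⇒∈ M M-maximal x λ u u∈M →
      ⊥-sym (H-isotropic (p ·v u) x (p·M⊆H u u∈M) x∈H u refl)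

  Admissible : V m k → Set
  Admissible x = M x × Torsion x

  open MaximalClique Admissible IndZero
  open FromEnumeration (allVectors k) ∈-allVectors

  G : Subset m k
  G = MaxClique

  G⊆M : _⊆_ m k G M
  G⊆M _ x∈G = proj₁ (proj₁ x∈G)

  G⊆V[ℓ] : _⊆_ m k G (Tors m k ℓ n)
  G⊆V[ℓ] _ x∈G = proj₂ (proj₁ x∈G)

  G-isotropic : IsIsotropicTors m k ℓ n ω G
  G-isotropic _ _ x∈G y∈G = IndZero-stable (MaxClique-compatible x∈G y∈G)

  private
    G-iso : ∀ {x y} → G x → G y → IndZero x y
    G-iso {x} {y} = G-isotropic x y

  -- G is closed under the module operations, each time by maximality of the clique
  G-zero : G 0v
  G-zero = MaxClique-maximal (M-zero , Torsion-zero) (IndZero-zeroʳ 0v)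
             λ a a∈G → IndZero-zeroʳ a , IndZero-zeroˡ (G⊆V[ℓ] a a∈G)
    where M-zero = proj₁ (proj₁ M-maximal)

  G-+ : ∀ x y → G x → G y → G (x +v y)
  G-+ x y x∈G y∈G =
    MaxClique-maximal (M-+ x y (G⊆M x x∈G) (G⊆M y y∈G) , ℓx+y≡0)
      (IndZero-+ˡ ℓx≡0 ℓy≡0 ℓx+y≡0 (IndZero-+ʳ (G-iso x∈G x∈G) (G-iso x∈G y∈G))
                                  (IndZero-+ʳ (G-iso y∈G x∈G) (G-iso y∈G y∈G)))
      λ a a∈G → IndZero-+ʳ (G-iso a∈G x∈G) (G-iso a∈G y∈G) ,
                IndZero-+ˡ ℓx≡0 ℓy≡0 (G⊆V[ℓ] a a∈G) (G-iso x∈G a∈G) (G-iso y∈G a∈G)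
    where
    M-+ = proj₁ (proj₂ (proj₁ M-maximal))
    ℓx≡0 = G⊆V[ℓ] x x∈G
    ℓy≡0 = G⊆V[ℓ] y y∈G
    ℓx+y≡0 = Torsion-+ ℓx≡0 ℓy≡0

  G-· : ∀ c x → G x → G (c ·v x)
  G-· c x x∈G =
    MaxClique-maximal (M-· c x (G⊆M x x∈G) , Torsion-· c ℓx≡0)
      (IndZero-·ˡ c ℓx≡0 (Torsion-· c ℓx≡0) (IndZero-·ʳ c (G-iso x∈G x∈G)))
      λ a a∈G → IndZero-·ʳ c (G-iso a∈G x∈G) ,
                IndZero-·ˡ c ℓx≡0 (G⊆V[ℓ] a a∈G) (G-iso x∈G a∈G)
    where ℓx≡0 = G⊆V[ℓ] x x∈G

  G-submodule : IsSubmodule m k G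
  G-submodule = G-zero , G-+ , G-·

  -- on p·M the induced pairing vanishes because M is isotropic
  p·M⊆G : ∀ u → M u → G (p ·v u)
  p·M⊆G u u∈M =
    MaxClique-maximal (M-· p u u∈M , Torsion-p· u)
      (IndZero-p·ʳ (⊥-·ˡ p (alternating u)))
      λ a a∈G → IndZero-p·ʳ (M-isotropic a u (G⊆M a a∈G) u∈M) ,
                IndZero-p·ˡ (G⊆V[ℓ] a a∈G) (M-isotropic u a u∈M (G⊆M a a∈G))

  G-maximal : ∀ H → IsSubgroupTors m k ℓ n H → IsIsotropicTors m k ℓ n ω H →
              _⊆_ m k G H → _⊆_ m k H G
  G-maximal H (_ , H⊆V[ℓ]) H-isotropic G⊆H x x∈H =
    MaxClique-maximal (x∈M , H⊆V[ℓ] x x∈H) (H-isotropic x x x∈H x∈H)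
      λ a a∈G → H-isotropic a x (G⊆H a a∈G) x∈H , H-isotropic x a x∈H (G⊆H a a∈G)
    where
    x∈M : M x
    x∈M = isotropic-⊇p·M⇒⊆M H H-isotropic (λ u u∈M → G⊆H _ (p·M⊆G u u∈M)) x x∈H

theorem6p14 : (ℓ n g : ℕ) → Prime ℓ → 1 ≤ n → 1 ≤ g → {{_ : NonZero (ℓ ^ n)}}
    → (ω : Pairing (ℓ ^ n) (2 * g)) → IsNondegenerateSymplectic (ℓ ^ n) (2 * g) ω
    → (M : Subset (ℓ ^ n) (2 * g)) → IsMaximalIsotropic (ℓ ^ n) (2 * g) ω M
    → Σ (Subset (ℓ ^ n) (2 * g)) λ G →
        (_⊆_ (ℓ ^ n) (2 * g) G M × _⊆_ (ℓ ^ n) (2 * g) G (Tors (ℓ ^ n) (2 * g) ℓ n))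
        × IsMaximalIsotropicTors (ℓ ^ n) (2 * g) ℓ n ω G
theorem6p14 ℓ (suc n) g _ (s≤s _) _ ω (additiveˡ , additiveʳ , alternating , _) M M-maximal =
  G , (G⊆M , G⊆V[ℓ]) , (G-submodule , G⊆V[ℓ]) , G-isotropic , G-maximal
  where
  open TorsionOfMaximalIsotropic (ℓ ^ suc n) (2 * g) ω additiveˡ additiveʳ alternating
                                 ℓ (suc n) refl M M-maximal
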